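{- Let $p$ be a prime, $N,\alpha_1,\dots,\alpha_N\in\mathbb{Z}^+$ with $\alpha_1\ge\dots\ge\alpha_N$, $\underline{\alpha}=(\alpha_1,\dots,\alpha_N)$, and $D\in\mathbb{N}$. Then $$\mathcal{V}_p(\underline{\alpha},D)>0\iff D<\sum_{i=1}^N(p^{\alpha_i}-1).$$
   Context: For $\underline{n}\in\mathbb{N}^N$, $\nu_p(\underline{\alpha},\underline{n}):=\sum_{i=1}^N\nu_p(\alpha_i,n_i)$ with $\nu_p(\alpha_i,n_i):=\alpha_i-\operatorname{ord}_p(n_i+1)$ if $n_i\le p^{\alpha_i}-1$ and $\infty$ otherwise ($\operatorname{ord}_p$ the $p$-adic valuation); equivalently $\nu_p(\alpha_i,n_i)=\operatorname{ord}_p\bigl(\sum_{x=0}^{p^{\alpha_i}-1}\binom{x}{n_i}\bigr)$. $\mathcal{V}_p(\underline{\alpha},D):=\min\{\nu_p(\underline{\alpha},\underline{n})\mid\underline{n}\in\mathbb{N}^N,\ n_1+\dots+n_N\le D\}$. -}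

module Defs where

open import Data.Nat using (ℕ; zero; suc; _+_; _*_; _∸_; _^_; _≤_; _<_; _≤?_)
open import Data.Nat.Divisibility using (_∣?_)
open import Data.Vec using (Vec; []; _∷_; sum)
open import Data.List using (List; []; _∷_; _++_; map; concatMap; filter; foldr; upTo)
open import Relation.Nullary.Decidable using (does)
open import Data.Bool using (if_then_else_)

data ℕ∞ : Set where
  fin : ℕ → ℕ∞
  ∞   : ℕ∞

_+∞_ : ℕ∞ → ℕ∞ → ℕ∞
fin a +∞ fin b = fin (a + b)
_     +∞ _     = ∞

min∞ : ℕ∞ → ℕ∞ → ℕ∞
min∞ ∞ y = y
min∞ x ∞ = x
min∞ (fin a) (fin b) = fin (Data.Nat._⊓_ a b)

data Pos∞ : ℕ∞ → Set where
  pos-fin : ∀ {a} → 0 < a → Pos∞ (fin a)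
  pos-∞   : Pos∞ ∞

-- p-adic valuation of m (for m ≥ 1, p ≥ 2):
-- the largest k ≤ m with p ^ k ∣ m  (note p ^ k > m whenever k > m)
ordSearch : ℕ → ℕ → ℕ → ℕ
ordSearch p m zero    = zero
ordSearch p m (suc k) = if does ((p ^ suc k) ∣? m) then suc k else ordSearch p m k

ord : ℕ → ℕ → ℕ
ord p m = ordSearch p m m

ν₁ : ℕ → ℕ → ℕ → ℕ∞
ν₁ p α n = if does (n ≤? (p ^ α ∸ 1)) then fin (α ∸ ord p (suc n)) else ∞

ν : ∀ {N} → ℕ → Vec ℕ N → Vec ℕ N → ℕ∞
ν p []       []       = fin 0
ν p (a ∷ as) (n ∷ ns) = ν₁ p a n +∞ ν p as ns

allVecs : (N B : ℕ) → List (Vec ℕ N)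
allVecs zero    B = [] ∷ []
allVecs (suc N) B = concatMap (λ k → map (k ∷_) (allVecs N B)) (upTo (suc B))

-- 𝒱_p(α̲, D) = min { ν_p(α̲, n̲) | n̲ ∈ ℕ^N, n_1 + … + n_N ≤ D }
-- (any such n̲ has all entries ≤ D, so the enumeration below covers the set;
--  the set is nonempty since it contains 0, so the fold's initial ∞ is harmless)
𝒱 : ∀ {N} → ℕ → Vec ℕ N → ℕ → ℕ∞
𝒱 {N} p α D = foldr min∞ ∞ (map (ν p α) (filter (λ n → sum n ≤? D) (allVecs N D)))

{-# OPTIONS --safe #-}
-- ν₁ p a n vanishes exactly at the top digit n = p^a − 1: the guard gives n + 1 ≤ p^a, and
-- a ∸ ord p (n + 1) = 0 gives p^a ∣ n + 1.  Since ν is a sum of such terms in ℕ ∪ {∞}, ν(α, n)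
-- vanishes only at the corner n = (p^{α_i} − 1)_i, whose coordinate sum is Σ (p^{α_i} − 1).
-- So the minimum 𝒱 over {n : Σ n ≤ D} is positive iff that corner lies outside the simplex.
module Submission where

open import Defs
open import Data.Nat using (ℕ; _∸_; _^_; _≤_; _<_; _≥_)
open import Data.Nat.Primality using (Prime)
open import Data.Fin using (toℕ)
open import Data.Vec using (Vec; lookup; map; sum)
open import Function.Bundles using (_⇔_)

open import Data.Bool using (true; false; T)
open import Data.Empty using (⊥-elim)
open import Data.List as List using ()
open import Data.List.Membership.Propositional using (_∈_; lose)
open import Data.List.Membership.Propositional.Properties
  using (∈-map⁺; ∈-map⁻; ∈-filter⁺; ∈-filter⁻; ∈-concatMap⁺; ∈-upTo⁺)
open import Data.List.Relation.Unary.Any using (here; there)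
open import Data.Nat using (zero; suc; _+_; _*_; z≤n; s≤s; s≤s⁻¹; _≤?_; _<?_; _≤ᵇ_)
open import Data.Nat.Base using (nonTrivial⇒n>1)
open import Data.Nat.Divisibility using (_∣_; _∣?_; ∣⇒≤; ∣-trans; ∣-refl; 1∣_; m∣m*n)
open import Data.Nat.Primality using (prime⇒nonTrivial)
open import Data.Nat.Properties
open import Data.Product using (_×_; _,_)
open import Data.Sum using (_⊎_; inj₁; inj₂)
open import Data.Vec using ([]; _∷_)
open import Function using (_∘′_)
open import Function.Bundles using (mk⇔)
open import Relation.Binary.PropositionalEquality
open import Relation.Nullary using (¬_; yes; no; contradiction)

p^ordSearch∣ : ∀ p m k → p ^ ordSearch p m k ∣ m
p^ordSearch∣ p m zero = 1∣ m
p^ordSearch∣ p m (suc k) with (p ^ suc k) ∣? m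
... | yes p^k∣m = p^k∣m
... | no _      = p^ordSearch∣ p m k

ordSearch-maximal : ∀ p m {j} k → j ≤ k → p ^ j ∣ m → j ≤ ordSearch p m k
ordSearch-maximal p m zero j≤k _ = j≤k
ordSearch-maximal p m (suc k) j≤k p^j∣m with (p ^ suc k) ∣? m
... | yes _ = j≤k
... | no p^k∤m with m≤n⇒m<n∨m≡n j≤k
...   | inj₁ j<k  = ordSearch-maximal p m k (s≤s⁻¹ j<k) p^j∣m
...   | inj₂ refl = contradiction p^j∣m p^k∤m

^-monoʳ-∣ : ∀ p {a b} → a ≤ b → p ^ a ∣ p ^ b
^-monoʳ-∣ p {a} {b} a≤b = subst (p ^ a ∣_) p^a*p^[b∸a]≡p^b (m∣m*n (p ^ (b ∸ a)))
  where
  p^a*p^[b∸a]≡p^b : p ^ a * p ^ (b ∸ a) ≡ p ^ b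
  p^a*p^[b∸a]≡p^b = trans (sym (^-distribˡ-+-* p a (b ∸ a))) (cong (p ^_) (m+[n∸m]≡n a≤b))

n<m^n : ∀ {m} → 1 < m → ∀ n → n < m ^ n
n<m^n 1<m zero    = s≤s z≤n
n<m^n {m} 1<m (suc n) = begin-strict
  suc n             <⟨ s≤s (n<m^n 1<m n) ⟩
  suc (m ^ n)       ≤⟨ +-monoˡ-≤ (m ^ n) (≤-trans (s≤s z≤n) (n<m^n 1<m n)) ⟩
  m ^ n + m ^ n     ≡⟨ cong (m ^ n +_) (sym (+-identityʳ (m ^ n))) ⟩
  2 * m ^ n         ≤⟨ *-monoˡ-≤ (m ^ n) 1<m ⟩
  m ^ suc n         ∎
  where open ≤-Reasoning

top : ∀ {N} → ℕ → Vec ℕ N → Vec ℕ N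
top p = map (λ a → p ^ a ∸ 1)

fin-injective : ∀ {x y} → fin x ≡ fin y → x ≡ y
fin-injective refl = refl

ν₁≡0⇒top : ∀ p a n → ν₁ p a n ≡ fin 0 → n ≡ p ^ a ∸ 1
ν₁≡0⇒top p a n ν₁≡0 with n ≤ᵇ p ^ a ∸ 1 in guard | ν₁≡0
... | true | a∸ord≡0 = ≤-antisym n≤top (∸-monoˡ-≤ 1 (∣⇒≤ p^a∣1+n))
  where
  n≤top : n ≤ p ^ a ∸ 1
  n≤top = ≤ᵇ⇒≤ n (p ^ a ∸ 1) (subst T (sym guard) _)
  p^a∣1+n : p ^ a ∣ suc n
  p^a∣1+n = ∣-trans (^-monoʳ-∣ p {a} {ord p (suc n)} (m∸n≡0⇒m≤n (fin-injective a∸ord≡0)))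
                    (p^ordSearch∣ p (suc n) (suc n))

ν₁-top : ∀ {p} → 1 < p → ∀ a → ν₁ p a (p ^ a ∸ 1) ≡ fin 0
ν₁-top {p} 1<p a with p ^ a ∸ 1 ≤ᵇ p ^ a ∸ 1 in guard
... | false = ⊥-elim (subst T guard (≤⇒≤ᵇ (≤-refl {p ^ a ∸ 1})))
... | true  = cong fin (m≤n⇒m∸n≡0 a≤ord)
  where
  1+top≡p^a : suc (p ^ a ∸ 1) ≡ p ^ a
  1+top≡p^a = m+[n∸m]≡n (≤-trans (s≤s z≤n) (n<m^n 1<p a))
  a≤ord : a ≤ ord p (suc (p ^ a ∸ 1))
  a≤ord = subst (λ m → a ≤ ord p m) (sym 1+top≡p^a)
    (ordSearch-maximal p (p ^ a) (p ^ a) (<⇒≤ (n<m^n 1<p a)) ∣-refl)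

+∞≡0⇒ : ∀ x y → x +∞ y ≡ fin 0 → x ≡ fin 0 × y ≡ fin 0
+∞≡0⇒ (fin zero) (fin zero) _ = refl , refl

ν≡0⇒top : ∀ p {N} (α n : Vec ℕ N) → ν p α n ≡ fin 0 → n ≡ top p α
ν≡0⇒top p []       []       _   = refl
ν≡0⇒top p (a ∷ as) (k ∷ ks) ν≡0 with ν₁≡0 , ν≡0′ ← +∞≡0⇒ (ν₁ p a k) (ν p as ks) ν≡0 =
  cong₂ _∷_ (ν₁≡0⇒top p a k ν₁≡0) (ν≡0⇒top p as ks ν≡0′)

ν-top : ∀ {p} → 1 < p → ∀ {N} (α : Vec ℕ N) → ν p α (top p α) ≡ fin 0
ν-top 1<p []       = refl
ν-top 1<p (a ∷ as) rewrite ν₁-top 1<p a | ν-top 1<p as = refl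

≡0⊎Pos∞ : ∀ x → x ≡ fin 0 ⊎ Pos∞ x
≡0⊎Pos∞ (fin zero)    = inj₁ refl
≡0⊎Pos∞ (fin (suc a)) = inj₂ (pos-fin (s≤s z≤n))
≡0⊎Pos∞ ∞             = inj₂ pos-∞

¬Pos∞0 : ¬ Pos∞ (fin 0)
¬Pos∞0 (pos-fin ())

ν-pos : ∀ p {N} (α n : Vec ℕ N) → n ≢ top p α → Pos∞ (ν p α n)
ν-pos p α n n≢top with ≡0⊎Pos∞ (ν p α n)
... | inj₁ ν≡0 = contradiction (ν≡0⇒top p α n ν≡0) n≢top
... | inj₂ pos = pos

min∞-pos : ∀ {x y} → Pos∞ x → Pos∞ y → Pos∞ (min∞ x y)
min∞-pos pos-∞         y>0           = y>0
min∞-pos (pos-fin a>0) pos-∞         = pos-fin a>0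
min∞-pos (pos-fin a>0) (pos-fin b>0) = pos-fin (⊓-glb a>0 b>0)

min∞-zeroʳ : ∀ x → min∞ x (fin 0) ≡ fin 0
min∞-zeroʳ (fin a) = cong fin (⊓-zeroʳ a)
min∞-zeroʳ ∞       = refl

foldr-min∞-pos : ∀ xs → (∀ {x} → x ∈ xs → Pos∞ x) → Pos∞ (List.foldr min∞ ∞ xs)
foldr-min∞-pos List.[]       _   = pos-∞
foldr-min∞-pos (x List.∷ xs) pos = min∞-pos (pos (here refl)) (foldr-min∞-pos xs (pos ∘′ there))

foldr-min∞-zero : ∀ xs → fin 0 ∈ xs → List.foldr min∞ ∞ xs ≡ fin 0
foldr-min∞-zero (_ List.∷ xs) (here refl) with List.foldr min∞ ∞ xs
... | fin _ = refl
... | ∞     = refl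
foldr-min∞-zero (x List.∷ xs) (there 0∈xs) rewrite foldr-min∞-zero xs 0∈xs = min∞-zeroʳ x

∈-allVecs : ∀ N B (v : Vec ℕ N) → sum v ≤ B → v ∈ allVecs N B
∈-allVecs zero    B []       _   = here refl
∈-allVecs (suc N) B (k ∷ vs) sum≤B =
  ∈-concatMap⁺ (λ k → List.map (k ∷_) (allVecs N B))
    (lose (∈-upTo⁺ (s≤s (≤-trans (m≤m+n k (sum vs)) sum≤B)))
    (∈-map⁺ (k ∷_) (∈-allVecs N B vs (≤-trans (m≤n+m (sum vs) k) sum≤B))))

𝒱-pos : ∀ p {N} (α : Vec ℕ N) D → (∀ n → sum n ≤ D → Pos∞ (ν p α n)) → Pos∞ (𝒱 p α D)
𝒱-pos p {N} α D pos = foldr-min∞-pos _ ν∈⇒pos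
  where
  ν∈⇒pos : ∀ {x} → x ∈ List.map (ν p α) (List.filter (λ n → sum n ≤? D) (allVecs N D)) → Pos∞ x
  ν∈⇒pos x∈ with n , n∈ , refl ← ∈-map⁻ (ν p α) x∈
            with _ , sum≤D ← ∈-filter⁻ (λ n → sum n ≤? D) {xs = allVecs N D} n∈ = pos n sum≤D

𝒱-zero : ∀ p {N} (α n : Vec ℕ N) D → sum n ≤ D → ν p α n ≡ fin 0 → 𝒱 p α D ≡ fin 0
𝒱-zero p {N} α n D sum≤D ν≡0 = foldr-min∞-zero _ (subst (_∈ _) ν≡0 (∈-map⁺ (ν p α) n∈))
  where
  n∈ : n ∈ List.filter (λ n → sum n ≤? D) (allVecs N D)
  n∈ = ∈-filter⁺ (λ n → sum n ≤? D) (∈-allVecs N D n sum≤D) sum≤D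

corollary4p2 : (p : ℕ) → Prime p → (N : ℕ) → 1 ≤ N → (α : Vec ℕ N)
    → (∀ i → 1 ≤ lookup α i)
    → (∀ i j → toℕ i ≤ toℕ j → lookup α i ≥ lookup α j)
    → (D : ℕ)
    → Pos∞ (𝒱 p α D) ⇔ (D < sum (map (λ a → p ^ a ∸ 1) α))
corollary4p2 p p-prime N _ α _ _ D = mk⇔ 𝒱-pos⇒corner-outside corner-outside⇒𝒱-pos
  where
  1<p : 1 < p
  1<p = nonTrivial⇒n>1 p {{prime⇒nonTrivial p-prime}}

  𝒱-pos⇒corner-outside : Pos∞ (𝒱 p α D) → D < sum (top p α)
  𝒱-pos⇒corner-outside 𝒱>0 with D <? sum (top p α)
  ... | yes D<sum = D<sum
  ... | no D≮sum  = ⊥-elim (¬Pos∞0 (subst Pos∞ 𝒱≡0 𝒱>0))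
    where
    𝒱≡0 : 𝒱 p α D ≡ fin 0
    𝒱≡0 = 𝒱-zero p α (top p α) D (≮⇒≥ D≮sum) (ν-top 1<p α)

  corner-outside⇒𝒱-pos : D < sum (top p α) → Pos∞ (𝒱 p α D)
  corner-outside⇒𝒱-pos D<sum = 𝒱-pos p α D λ n sum≤D →
    ν-pos p α n λ n≡top → <⇒≱ D<sum (subst (λ v → sum v ≤ D) n≡top sum≤D)
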